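{- Let $(S,\tau)$ be one of the following topological spaces: $\mathbb N$ or $\mathbb Z$ with the cofinite topology, or $\mathbb N$ or $\mathbb Z$ with the density one topology. Then for every non-empty open set $U\in\tau$, every locally LIP function on $U$ is LIP on $U$ (i.e. the rings $LIP(U)$, $U$ non-empty open, with restriction maps form a sheaf on $(S,\tau)$).
   Context: For an infinite $U\subseteq\mathbb Z$, a function $f\colon U\to\mathbb Z$ is LIP on $U$ if for every finite $X\subseteq U$ there is $p\in\mathbb Z[x]$ with $p(x)=f(x)$ for all $x\in X$; $LIP(U)$ is the ring of such functions. Given a topology $\tau$ on $S$ in which all non-empty open sets are infinite and a non-empty open $U$, a function $f\colon U\to\mathbb Z$ is locally LIP on $U$ if every $a\in U$ has an open set $U_a\subseteq U$ with $a\in U_a$ such that $f|_{U_a}$ is LIP on $U_a$. The cofinite topology on $S$: the non-empty open sets are the complements in $S$ of finite sets. The density one topology on $\mathbb N$: non-empty open sets are $U\subseteq\mathbb N$ with $\lim_{x\to+\infty}\frac{|\{n\in U: n\le x\}|}{|\{n\in\mathbb N: n\le x\}|}=1$. The density one topology on $\mathbb Z$: non-empty open sets are $U\subseteq\mathbb Z$ with $\lim_{x\to+\infty}\frac{|\{n\in U: |n|\le x\}|}{|\{n\in\mathbb Z: |n|\le x\}|}=1$. -}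

module Defs where

open import Data.Nat as ℕ using (ℕ; zero; suc; _≥_)
open import Data.Integer as ℤ using (ℤ; +_; -[1+_])
open import Data.Bool using (Bool; true; false)
open import Data.List using (List; []; _∷_)
open import Data.List.Relation.Unary.All using (All)
open import Data.List.Membership.Propositional using (_∈_)
open import Data.Product using (Σ; ∃; _×_; _,_)
open import Data.Rational as ℚ using (ℚ; _/_; 1ℚ; 0ℚ)
open import Relation.Nullary using (¬_)
open import Relation.Binary.PropositionalEquality using (_≡_)
open import Function.Bundles using (_⇔_)

Subset : Set → Set
Subset S = S → Bool

_∈ₛ_ : {S : Set} → S → Subset S → Set
x ∈ₛ U = U x ≡ true

_⊆ₛ_ : {S : Set} → Subset S → Subset S → Set
V ⊆ₛ U = ∀ x → x ∈ₛ V → x ∈ₛ U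

NonEmpty : {S : Set} → Subset S → Set
NonEmpty {S} U = Σ S λ a → a ∈ₛ U

-- Polynomials in ℤ[x] as coefficient lists (constant term first).
Poly : Set
Poly = List ℤ

eval : Poly → ℤ → ℤ
eval []       x = + 0
eval (c ∷ cs) x = c ℤ.+ x ℤ.* eval cs x

-- f : U → ℤ represented as a total function S → ℤ whose values off U are ignored.
-- ι embeds S into ℤ.
-- LIP on U: every finite X ⊆ U is interpolated by some integer polynomial.
IsLIP : {S : Set} → (S → ℤ) → Subset S → (S → ℤ) → Set
IsLIP {S} ι U f =
  (X : List S) → All (λ x → x ∈ₛ U) X →
  Σ Poly λ p → All (λ x → eval p (ι x) ≡ f x) X

-- IsOpen: the predicate "is a non-empty open set" of the topology.
IsLocallyLIP : {S : Set} → (S → ℤ) → (Subset S → Set) → Subset S → (S → ℤ) → Set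
IsLocallyLIP {S} ι IsOpen U f =
  (a : S) → a ∈ₛ U →
  Σ (Subset S) λ V → IsOpen V × V ⊆ₛ U × a ∈ₛ V × IsLIP ι V f

LIPSheaf : (S : Set) → (S → ℤ) → (Subset S → Set) → Set
LIPSheaf S ι IsOpen =
  (U : Subset S) → IsOpen U → NonEmpty U →
  (f : S → ℤ) → IsLocallyLIP ι IsOpen U f → IsLIP ι U f

CofiniteOpen : {S : Set} → Subset S → Set
CofiniteOpen {S} U = Σ (List S) λ F → (x : S) → (x ∈ₛ U ⇔ (¬ (x ∈ F)))

bit : Bool → ℕ
bit true  = 1
bit false = 0

countℕ : Subset ℕ → ℕ → ℕ
countℕ U zero    = bit (U zero)
countℕ U (suc x) = countℕ U x ℕ.+ bit (U (suc x))

countℤ : Subset ℤ → ℕ → ℕ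
countℤ U zero    = bit (U (+ 0))
countℤ U (suc x) = countℤ U x ℕ.+ bit (U (+ suc x)) ℕ.+ bit (U -[1+ x ])

-- density one topology on ℕ: lim_{x→∞} |{n∈U : n≤x}| / |{n∈ℕ : n≤x}| = 1
-- (|{n∈ℕ : n≤x}| = x+1; it suffices to take x ∈ ℕ since both counts are step functions)
DensityOneℕ : Subset ℕ → Set
DensityOneℕ U =
  (ε : ℚ) → 0ℚ ℚ.< ε →
  Σ ℕ λ N → (x : ℕ) → x ≥ N →
    ℚ.∣ ((+ countℕ U x) / suc x) ℚ.- 1ℚ ∣ ℚ.< ε

-- density one topology on ℤ: lim_{x→∞} |{n∈U : |n|≤x}| / |{n∈ℤ : |n|≤x}| = 1
-- (|{n∈ℤ : |n|≤x}| = 2x+1)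
DensityOneℤ : Subset ℤ → Set
DensityOneℤ U =
  (ε : ℚ) → 0ℚ ℚ.< ε →
  Σ ℕ λ N → (x : ℕ) → x ≥ N →
    ℚ.∣ ((+ countℤ U x) / suc (x ℕ.+ x)) ℚ.- 1ℚ ∣ ℚ.< ε

-- Interpolate f on a finite X ⊆ U one point at a time. If p interpolates f on T, so does
-- p + c · ∏_{t ∈ T} (z − t), and this takes the value f(x) at a new point x once
-- N = ∏_{t ∈ T} (x − t) divides f(x) − p(x). Let q interpolate f on {x, y} for some y in a
-- neighbourhood of x on which f is LIP, and suppose p interpolates f at y as well. As
-- a − b ∣ r(a) − r(b) for every integer polynomial r, the difference
-- f(x) − p(x) = (q(x) − q(y)) − (p(x) − p(y)) is divisible by x − y, hence by N if N ∣ x − y.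
-- So the induction carries finitely many open sets such that f is interpolable on the points
-- treated so far plus any finite subset of their intersection, and it needs every finite
-- intersection of open sets to meet every residue class. In all four topologies such
-- intersections contain arbitrarily long runs of consecutive naturals: cofinite sets trivially,
-- and finite intersections of density one sets have density one, while a set missing a point
-- in each of B consecutive blocks of length L misses B of the first BL naturals.

module Submission where

open import Defs
open import Data.Bool using (Bool; true; false; not; _∧_)
open import Data.Bool.Properties using (T-≡)
open import Data.Empty using (⊥-elim)
open import Data.Integer as ℤ using (ℤ; +_; 0ℤ)
import Data.Integer.Properties as ℤP
open import Data.Integer.Divisibility.Signed using (_∣_; divides; ∣-refl; ∣-trans; m∣∣m∣; ∣m∣n⇒∣m+n; ∣m∣n⇒∣m-n; ∣n⇒∣m*n)
open import Data.Bool.ListAction using (all)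
open import Data.List using (List; []; _∷_; _++_; map)
open import Data.List.Membership.Propositional using (_∈_)
open import Data.List.Membership.Propositional.Properties using (∈-map⁺; ∈-map⁻)
open import Data.List.Relation.Unary.All as All using (All; []; _∷_)
import Data.List.Relation.Unary.All.Properties as AllP
open import Data.List.Relation.Unary.Any using (here; there)
open import Data.Nat as ℕ using (ℕ; zero; suc)
import Data.Nat.Properties as ℕP
open import Data.Product using (Σ; ∃; _×_; _,_)
open import Data.Sum using (inj₁; inj₂)
open import Function using (id; _∘_)
open import Function.Bundles using (Equivalence)
open import Relation.Binary.PropositionalEquality

module _ where
  open import Data.Integer using (_+_; _*_; _-_; -_)
  open import Data.Integer.Tactic.RingSolver using (solve-∀)

  infixl 6 _+ₚ_
  infixr 7 _·ₚ_

  _+ₚ_ : Poly → Poly → Poly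
  []      +ₚ q       = q
  (a ∷ p) +ₚ []      = a ∷ p
  (a ∷ p) +ₚ (b ∷ q) = a + b ∷ p +ₚ q

  _·ₚ_ : ℤ → Poly → Poly
  c ·ₚ p = map (c *_) p

  vanishing : List ℤ → Poly
  vanishing []       = + 1 ∷ []
  vanishing (a ∷ as) = (0ℤ ∷ vanishing as) +ₚ (- a) ·ₚ vanishing as

  eval-+ₚ : ∀ p q z → eval (p +ₚ q) z ≡ eval p z + eval q z
  eval-+ₚ []      q       z = sym (ℤP.+-identityˡ _)
  eval-+ₚ (a ∷ p) []      z = sym (ℤP.+-identityʳ _)
  eval-+ₚ (a ∷ p) (b ∷ q) z rewrite eval-+ₚ p q z = regroup a b z (eval p z) (eval q z)
    where
    regroup : ∀ a b z u v → (a + b) + z * (u + v) ≡ (a + z * u) + (b + z * v)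
    regroup = solve-∀

  eval-·ₚ : ∀ c p z → eval (c ·ₚ p) z ≡ c * eval p z
  eval-·ₚ c []      z = sym (ℤP.*-zeroʳ c)
  eval-·ₚ c (a ∷ p) z rewrite eval-·ₚ c p z = factor c a z (eval p z)
    where
    factor : ∀ c a z u → c * a + z * (c * u) ≡ c * (a + z * u)
    factor = solve-∀

  eval-vanishing-[] : ∀ z → eval (vanishing []) z ≡ + 1
  eval-vanishing-[] z = cong (_+_ (+ 1)) (ℤP.*-zeroʳ z)

  eval-vanishing-∷ : ∀ a as z → eval (vanishing (a ∷ as)) z ≡ (z - a) * eval (vanishing as) z
  eval-vanishing-∷ a as z
    rewrite eval-+ₚ (0ℤ ∷ vanishing as) ((- a) ·ₚ vanishing as) z
          | eval-·ₚ (- a) (vanishing as) z = factor a z (eval (vanishing as) z)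
    where
    factor : ∀ a z u → (0ℤ + z * u) + (- a) * u ≡ (z - a) * u
    factor = solve-∀

  vanishing-root : ∀ {a as} → a ∈ as → eval (vanishing as) a ≡ 0ℤ
  vanishing-root {a} {_ ∷ as} (here refl) = begin
    eval (vanishing (a ∷ as)) a       ≡⟨ eval-vanishing-∷ a as a ⟩
    (a - a) * eval (vanishing as) a   ≡⟨ cong (_* eval (vanishing as) a) (ℤP.+-inverseʳ a) ⟩
    0ℤ * eval (vanishing as) a        ≡⟨ ℤP.*-zeroˡ (eval (vanishing as) a) ⟩
    0ℤ                                ∎
    where open ≡-Reasoning
  vanishing-root {a} {b ∷ as} (there a∈as) = begin
    eval (vanishing (b ∷ as)) a       ≡⟨ eval-vanishing-∷ b as a ⟩
    (a - b) * eval (vanishing as) a   ≡⟨ cong ((a - b) *_) (vanishing-root a∈as) ⟩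
    (a - b) * 0ℤ                      ≡⟨ ℤP.*-zeroʳ (a - b) ⟩
    0ℤ                                ∎
    where open ≡-Reasoning

  vanishing≡0⇒∈ : ∀ {z} as → eval (vanishing as) z ≡ 0ℤ → z ∈ as
  vanishing≡0⇒∈ {z} [] eq with () ← trans (sym (eval-vanishing-[] z)) eq
  vanishing≡0⇒∈ {z} (a ∷ as) eq
    with ℤP.i*j≡0⇒i≡0∨j≡0 (z - a) (trans (sym (eval-vanishing-∷ a as z)) eq)
  ... | inj₁ z-a≡0 = here (ℤP.i-j≡0⇒i≡j z a z-a≡0)
  ... | inj₂ rest≡0 = there (vanishing≡0⇒∈ as rest≡0)

  sub∣eval-sub : ∀ p a b → a - b ∣ eval p a - eval p b
  sub∣eval-sub []      a b = divides 0ℤ refl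
  sub∣eval-sub (c ∷ p) a b =
    subst (a - b ∣_) (expand c a b (eval p a) (eval p b))
      (∣m∣n⇒∣m+n (∣n⇒∣m*n a (sub∣eval-sub p a b)) (∣n⇒∣m*n (eval p b) ∣-refl))
    where
    expand : ∀ c a b pa pb → a * (pa - pb) + pb * (a - b) ≡ (c + a * pa) - (c + b * pb)
    expand = solve-∀

module _ {S : Set} (ι : S → ℤ) (f : S → ℤ) where
  open import Data.Integer using (_+_; _*_; _-_)
  open import Data.Integer.Tactic.RingSolver using (solve-∀)

  Interpolates : Poly → List S → Set
  Interpolates p = All (λ x → eval p (ι x) ≡ f x)

  interpolates-root : (∀ {a b} → ι a ≡ ι b → a ≡ b) → ∀ {p x T} → Interpolates p T →
                      eval (vanishing (map ι T)) (ι x) ≡ 0ℤ → Interpolates p (x ∷ T)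
  interpolates-root ι-injective {p} {x} {T} p-T root
    with ∈-map⁻ ι (vanishing≡0⇒∈ (map ι T) root)
  ... | t , t∈T , ιx≡ιt =
    subst (λ s → eval p (ι s) ≡ f s) (sym (ι-injective ιx≡ιt)) (All.lookup p-T t∈T) ∷ p-T

  interpolates-extend : ∀ {pA pB x y T} → Interpolates pA T → eval pA (ι y) ≡ f y →
                        Interpolates pB (x ∷ y ∷ []) →
                        eval (vanishing (map ι T)) (ι x) ∣ ι x - ι y →
                        Σ Poly λ q → Interpolates q (x ∷ T)
  interpolates-extend {pA} {pB} {x} {y} {T} pA-T pA-y (pB-x ∷ pB-y ∷ []) N∣x-y =
    pA +ₚ c ·ₚ P , q-x ∷ All.tabulate q-t
    where
    P = vanishing (map ι T)
    N = eval P (ι x)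

    x-y∣defect : ι x - ι y ∣ f x - eval pA (ι x)
    x-y∣defect = subst (ι x - ι y ∣_) defect-eq
      (∣m∣n⇒∣m-n (sub∣eval-sub pB (ι x) (ι y)) (sub∣eval-sub pA (ι x) (ι y)))
      where
      cancel : ∀ u v w → (u - w) - (v - w) ≡ u - v
      cancel = solve-∀
      defect-eq : (eval pB (ι x) - eval pB (ι y)) - (eval pA (ι x) - eval pA (ι y))
                ≡ f x - eval pA (ι x)
      defect-eq = trans
        (cong₂ (λ u v → (u - v) - (eval pA (ι x) - eval pA (ι y))) pB-x (trans pB-y (sym pA-y)))
        (cancel (f x) (eval pA (ι x)) (eval pA (ι y)))

    open _∣_ (∣-trans N∣x-y x-y∣defect) renaming (quotient to c; equality to defect≡cN)

    eval-q : ∀ z → eval (pA +ₚ c ·ₚ P) z ≡ eval pA z + c * eval P z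
    eval-q z = trans (eval-+ₚ pA (c ·ₚ P) z) (cong (_+_ (eval pA z)) (eval-·ₚ c P z))

    q-x : eval (pA +ₚ c ·ₚ P) (ι x) ≡ f x
    q-x = begin
      eval (pA +ₚ c ·ₚ P) (ι x)        ≡⟨ eval-q (ι x) ⟩
      eval pA (ι x) + c * N            ≡⟨ cong (_+_ (eval pA (ι x))) (sym defect≡cN) ⟩
      eval pA (ι x) + (f x - eval pA (ι x)) ≡⟨ cancel (eval pA (ι x)) (f x) ⟩
      f x                              ∎
      where
      open ≡-Reasoning
      cancel : ∀ u v → u + (v - u) ≡ v
      cancel = solve-∀

    q-t : ∀ {t} → t ∈ T → eval (pA +ₚ c ·ₚ P) (ι t) ≡ f t
    q-t {t} t∈T = begin
      eval (pA +ₚ c ·ₚ P) (ι t)   ≡⟨ eval-q (ι t) ⟩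
      eval pA (ι t) + c * eval P (ι t) ≡⟨ cong (λ v → eval pA (ι t) + c * v) (vanishing-root (∈-map⁺ ι t∈T)) ⟩
      eval pA (ι t) + c * 0ℤ      ≡⟨ cong (_+_ (eval pA (ι t))) (ℤP.*-zeroʳ c) ⟩
      eval pA (ι t) + 0ℤ          ≡⟨ ℤP.+-identityʳ _ ⟩
      eval pA (ι t)               ≡⟨ All.lookup pA-T t∈T ⟩
      f t                         ∎
      where open ≡-Reasoning

MeetsAllResidues : {S : Set} → (S → ℤ) → (Subset S → Set) → Set
MeetsAllResidues {S} ι IsOpen =
  (Ws : List (Subset S)) → All IsOpen Ws → (m : ℕ) (r : ℤ) →
  Σ S λ y → All (y ∈ₛ_) Ws × (+ suc m ∣ r ℤ.- ι y)

module _ {S : Set} (ι : S → ℤ) (ι-injective : ∀ {a b} → ι a ≡ ι b → a ≡ b)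
         (IsOpen : Subset S → Set) (meets : MeetsAllResidues ι IsOpen) where

  Extendable : (S → ℤ) → List S → Set
  Extendable f X =
    Σ (List (Subset S)) λ Ws → All IsOpen Ws ×
      ((Z : List S) → All (λ z → All (z ∈ₛ_) Ws) Z → Σ Poly λ p → Interpolates ι f p (X ++ Z))

  extendable-[] : ∀ {f V} → IsOpen V → IsLIP ι V f → Extendable f []
  extendable-[] {V = V} oV lipV = V ∷ [] , oV ∷ [] , λ Z Z⊆V → lipV Z (All.map All.head Z⊆V)

  extendable-∷ : ∀ {f V x X} → IsOpen V → x ∈ₛ V → IsLIP ι V f → Extendable f X → Extendable f (x ∷ X)
  extendable-∷ {f} {V} {x} {X} oV xV lipV (Ws , oWs , interp) =
    V ∷ Ws , oV ∷ oWs , λ Z Z⊆ → add-x Z (All.map All.tail Z⊆)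
    where
    add-x : ∀ Z → All (λ z → All (z ∈ₛ_) Ws) Z → Σ Poly λ p → Interpolates ι f p (x ∷ X ++ Z)
    add-x Z Z⊆Ws with ℤ.∣ eval (vanishing (map ι (X ++ Z))) (ι x) ∣ in ∣N∣≡
    ... | zero with interp Z Z⊆Ws
    ...   | p , p-XZ = p , interpolates-root ι f ι-injective {p} p-XZ (ℤP.∣i∣≡0⇒i≡0 ∣N∣≡)
    add-x Z Z⊆Ws | suc m with meets (V ∷ Ws) (oV ∷ oWs) m (ι x)
    ... | y , yV ∷ yWs , m∣x-y
        with interp (y ∷ Z) (yWs ∷ Z⊆Ws) | lipV (x ∷ y ∷ []) (xV ∷ yV ∷ [])
    ... | pA , pA-XyZ | pB , pB-xy with AllP.++⁻ X pA-XyZ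
    ... | pA-X , pA-y ∷ pA-Z =
      interpolates-extend ι f {pA} {pB} (AllP.++⁺ pA-X pA-Z) pA-y pB-xy
        (∣-trans m∣∣m∣ (subst (λ k → + k ∣ ι x ℤ.- ι y) (sym ∣N∣≡) m∣x-y))

  extendable : ∀ {U f a} → IsLocallyLIP ι IsOpen U f → a ∈ₛ U → ∀ X → All (_∈ₛ U) X → Extendable f X
  extendable {a = a} locLIP aU [] [] with locLIP a aU
  ... | V , oV , _ , _ , lipV = extendable-[] oV lipV
  extendable locLIP aU (x ∷ X) (xU ∷ X⊆U) with locLIP x xU
  ... | V , oV , _ , xV , lipV = extendable-∷ oV xV lipV (extendable locLIP aU X X⊆U)

  locallyLIP⇒LIP : LIPSheaf S ι IsOpen
  locallyLIP⇒LIP U _ (a , aU) f locLIP X X⊆U =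
    let (_ , _ , interp) = extendable locLIP aU X X⊆U
        (p , p-X) = interp [] []
    in p , AllP.++⁻ˡ X p-X

HasLongRuns : (ℕ → Set) → Set
HasLongRuns P = (L : ℕ) → ∃ λ a → (j : ℕ) → j ℕ.< L → P (a ℕ.+ j)

LongRunsInIntersections : {S : Set} → (ℕ → S) → (Subset S → Set) → Set
LongRunsInIntersections {S} g IsOpen =
  (Ws : List (Subset S)) → All IsOpen Ws → HasLongRuns (λ n → All (g n ∈ₛ_) Ws)

module _ where
  open import Data.Integer using (_+_; _*_; _-_)
  open import Data.Integer.DivMod using (_%ℕ_; _/ℕ_; a≡a%ℕn+[a/ℕn]*n; n%ℕd<d)
  open import Data.Integer.Tactic.RingSolver using (solve-∀)

  longRuns⇒residues : ∀ {P} → HasLongRuns P → (m : ℕ) (r : ℤ) → ∃ λ n → P n × (+ suc m ∣ r - + n)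
  longRuns⇒residues runs m r with runs (suc m)
  ... | a , run = a ℕ.+ j , run j (n%ℕd<d k (suc m)) , divides Q r-[a+j]≡Qd
    where
    k = r - + a
    j = k %ℕ suc m
    Q = k /ℕ suc m
    shift : ∀ r a j → r - (a + j) ≡ (r - a) - j
    shift = solve-∀
    cancel : ∀ j v → (j + v) - j ≡ v
    cancel = solve-∀
    r-[a+j]≡Qd : r - + (a ℕ.+ j) ≡ Q * + suc m
    r-[a+j]≡Qd = begin
      r - + (a ℕ.+ j)          ≡⟨ cong (r -_) (ℤP.pos-+ a j) ⟩
      r - (+ a + + j)          ≡⟨ shift r (+ a) (+ j) ⟩
      k - + j                  ≡⟨ cong (_- + j) (a≡a%ℕn+[a/ℕn]*n k (suc m)) ⟩
      (+ j + Q * + suc m) - + j ≡⟨ cancel (+ j) (Q * + suc m) ⟩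
      Q * + suc m              ∎
      where open ≡-Reasoning

  longRuns⇒meetsAllResidues : ∀ {S : Set} {ι : S → ℤ} {g : ℕ → S} {IsOpen} → (∀ n → ι (g n) ≡ + n) →
                              LongRunsInIntersections g IsOpen → MeetsAllResidues ι IsOpen
  longRuns⇒meetsAllResidues {g = g} ι∘g runs Ws oWs m r with longRuns⇒residues (runs Ws oWs) m r
  ... | n , n∈Ws , m∣r-n = g n , n∈Ws , subst (λ v → + suc m ∣ r - v) (sym (ι∘g n)) m∣r-n

Eventually : (ℕ → Set) → Set
Eventually P = ∃ λ N → (n : ℕ) → N ℕ.≤ n → P n

eventually-× : ∀ {P Q} → Eventually P → Eventually Q → Eventually (λ n → P n × Q n)
eventually-× (M , p) (N , q) =
  M ℕ.+ N , λ n M+N≤n → p n (ℕP.m+n≤o⇒m≤o M M+N≤n) , q n (ℕP.m+n≤o⇒n≤o M M+N≤n)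

eventually-All : ∀ {A : Set} {P : A → ℕ → Set} {xs} →
                 All (λ x → Eventually (P x)) xs → Eventually (λ n → All (λ x → P x n) xs)
eventually-All [] = 0 , λ _ _ → []
eventually-All (e ∷ es) with eventually-× e (eventually-All es)
... | N , both = N , λ n N≤n → let (p , ps) = both n N≤n in p ∷ ps

eventually⇒longRuns : ∀ {P} → Eventually P → HasLongRuns P
eventually⇒longRuns (N , p) _ = N , λ j _ → p (N ℕ.+ j) (ℕP.m≤m+n N j)

module _ {S : Set} (ι : S → ℤ) (g : ℕ → S) (ι∘g : ∀ n → ι (g n) ≡ + n) where
  open import Data.List.Relation.Unary.All.Properties using (All¬⇒¬Any)

  eventually-≢ : ∀ s → Eventually (λ n → g n ≢ s)
  eventually-≢ s = suc ℤ.∣ ι s ∣ , λ { n ∣ιs∣<n refl → ℕP.<-irrefl (cong ℤ.∣_∣ (ι∘g n)) ∣ιs∣<n }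

  cofinite-eventually : ∀ {V} → CofiniteOpen V → Eventually (λ n → g n ∈ₛ V)
  cofinite-eventually (F , V⇔∉F) with eventually-All (All.universal eventually-≢ F)
  ... | N , avoids = N , λ n N≤n → Equivalence.from (V⇔∉F (g n)) (All¬⇒¬Any (avoids n N≤n))

  cofinite-longRuns : LongRunsInIntersections g CofiniteOpen
  cofinite-longRuns _ oWs = eventually⇒longRuns (eventually-All (All.map cofinite-eventually oWs))

module _ where
  open import Data.Integer using (_-_; _*_; _<_; _≤_; +≤+)
  open import Data.Integer.Tactic.RingSolver using (solve-∀)
  open import Data.Nat.Coprimality using (1-coprimeTo)
  open import Data.Rational as ℚ using (ℚ; mkℚ; 0ℚ; 1ℚ; toℚᵘ)
  import Data.Rational.Properties as ℚP
  open import Data.Rational.Unnormalised as ℚᵘ using (mkℚᵘ; *<*; *≤*)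
  import Data.Rational.Unnormalised.Properties as ℚᵘP

  1/[1+_] : ℕ → ℚ
  1/[1+ K ] = mkℚ (+ 1) K (1-coprimeTo (suc K))

  1/[1+]-pos : ∀ K → 0ℚ ℚ.< 1/[1+ K ]
  1/[1+]-pos K = ℚ.*<* (ℤ.+<+ (ℕ.s≤s ℕ.z≤n))

  -p≤∣p∣ : ∀ p → ℚᵘ.- p ℚᵘ.≤ ℚᵘ.∣ p ∣
  -p≤∣p∣ (mkℚᵘ (+ n)    d) = *≤* (ℤP.*-monoʳ-≤-nonNeg (+ suc d) (ℤP.neg-≤-pos {n} {n}))
  -p≤∣p∣ (mkℚᵘ ℤ.-[1+ n ] d) = ℚᵘP.≤-refl

  near-one : ∀ c d K → ℚ.∣ (+ c) ℚ./ suc d ℚ.- 1ℚ ∣ ℚ.< 1/[1+ K ] → (+ suc d - + c) * + suc K < + suc d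
  near-one c d K close with ℚᵘP.≤-<-trans (-p≤∣p∣ (u ℚᵘ.- ℚᵘ.1ℚᵘ)) (ℚᵘP.<-respˡ-≃ toℚᵘ-lhs (ℚP.toℚᵘ-mono-< close))
    where
    q = (+ c) ℚ./ suc d
    u = mkℚᵘ (+ c) d
    toℚᵘ-lhs : toℚᵘ ℚ.∣ q ℚ.- 1ℚ ∣ ℚᵘ.≃ ℚᵘ.∣ u ℚᵘ.- ℚᵘ.1ℚᵘ ∣
    toℚᵘ-lhs = ℚᵘP.≃-trans (ℚP.toℚᵘ-homo-∣-∣ (q ℚ.- 1ℚ)) (ℚᵘP.∣-∣-cong
      (ℚᵘP.≃-trans (ℚP.toℚᵘ-homo-+ q (ℚ.- 1ℚ)) (ℚᵘP.+-congˡ (ℚᵘ.- ℚᵘ.1ℚᵘ) (ℚP.toℚᵘ-fromℚᵘ u))))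
  -- cross is −(u − 1) < 1/(K+1) cross-multiplied, with ℚᵘ's unreduced numerator and denominator.
  ... | *<* cross = subst₂ _<_ (cong (_* + suc K) (numerator (+ c) (+ suc d))) denominator cross
    where
    numerator : ∀ c D → ℤ.- (c * + 1 ℤ.+ ℤ.-[1+ 0 ] * D) ≡ D - c
    numerator = solve-∀
    denominator : + 1 * + suc (d ℕ.* 1) ≡ + suc d
    denominator = trans (ℤP.*-identityˡ _) (cong (λ n → + suc n) (ℕP.*-identityʳ d))

  gap-bound : ∀ m c n K → m ℕ.+ c ℕ.≤ n → (+ n - + c) * + suc K < + n → K ℕ.* m ℕ.< n
  gap-bound m c n K m+c≤n gap = ℕP.≤-<-trans K*m≤m*[1+K] (ℤP.drop‿+<+ (begin-strict
    + (m ℕ.* suc K)           ≡⟨ ℤP.pos-* m (suc K) ⟩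
    + m * + suc K             ≤⟨ ℤP.*-monoʳ-≤-nonNeg (+ suc K) m≤n-c ⟩
    (+ n - + c) * + suc K     <⟨ gap ⟩
    + n                       ∎))
    where
    open ℤP.≤-Reasoning
    K*m≤m*[1+K] : K ℕ.* m ℕ.≤ m ℕ.* suc K
    K*m≤m*[1+K] = ℕP.≤-trans (ℕP.*-monoˡ-≤ m (ℕP.n≤1+n K)) (ℕP.≤-reflexive (ℕP.*-comm (suc K) m))
    m≤n-c : + m ≤ + n - + c
    m≤n-c = subst (+ m ≤_) (sym (trans (ℤP.m-n≡m⊖n n c) (ℤP.⊖-≥ (ℕP.m+n≤o⇒n≤o m m+c≤n))))
                  (+≤+ (ℕP.m+n≤o⇒m≤o∸n m m+c≤n))

module _ where
  open import Data.Nat using (_+_; _*_; _≤_; _<_; z≤n; s≤s; s≤s⁻¹)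
  open import Data.Nat.Properties
  open import Data.Nat.Tactic.RingSolver using (solve-∀)
  open import Algebra.Properties.CommutativeSemigroup +-commutativeSemigroup using (interchange)
  open import Relation.Nullary using (yes; no)

  misses : (ℕ → Bool) → ℕ → ℕ
  misses P zero    = 0
  misses P (suc n) = misses P n + bit (not (P n))

  HasDensityOne : (ℕ → Bool) → Set
  HasDensityOne P = ∀ K → Eventually (λ n → K * misses P n ≤ n)

  misses-mono : ∀ P {m n} → m ≤ n → misses P m ≤ misses P n
  misses-mono P {n = zero}  z≤n  = ≤-refl
  misses-mono P {n = suc n} m≤1+n with m≤n⇒m<n∨m≡n m≤1+n
  ... | inj₁ m<1+n = ≤-trans (misses-mono P (s≤s⁻¹ m<1+n)) (m≤m+n _ _)
  ... | inj₂ refl  = ≤-refl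

  misses-false : ∀ P n → P n ≡ false → misses P (suc n) ≡ suc (misses P n)
  misses-false P n Pn≡false rewrite Pn≡false = +-comm (misses P n) 1

  misses-∧ : ∀ P Q n → misses (λ i → P i ∧ Q i) n ≤ misses P n + misses Q n
  misses-∧ P Q zero    = z≤n
  misses-∧ P Q (suc n) = begin
    misses (λ i → P i ∧ Q i) n + bit (not (P n ∧ Q n))
      ≤⟨ +-mono-≤ (misses-∧ P Q n) (bit-not-∧ (P n) (Q n)) ⟩
    (misses P n + misses Q n) + (bit (not (P n)) + bit (not (Q n)))
      ≡⟨ interchange (misses P n) (misses Q n) _ _ ⟩
    (misses P n + bit (not (P n))) + (misses Q n + bit (not (Q n))) ∎
    where
    open ≤-Reasoning
    bit-not-∧ : ∀ a b → bit (not (a ∧ b)) ≤ bit (not a) + bit (not b)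
    bit-not-∧ true  b = ≤-refl
    bit-not-∧ false b = s≤s z≤n

  hasDensityOne-true : HasDensityOne (λ _ → true)
  hasDensityOne-true K = 0 , λ n _ → ≤-trans (≤-reflexive (trans (cong (K *_) (no-misses n)) (*-zeroʳ K))) z≤n
    where
    no-misses : ∀ n → misses (λ _ → true) n ≡ 0
    no-misses zero    = refl
    no-misses (suc n) = trans (+-identityʳ _) (no-misses n)

  hasDensityOne-∧ : ∀ {P Q} → HasDensityOne P → HasDensityOne Q → HasDensityOne (λ i → P i ∧ Q i)
  hasDensityOne-∧ {P} {Q} P-dense Q-dense K with eventually-× (P-dense (2 * K)) (Q-dense (2 * K))
  ... | N , sparse = N , λ n N≤n → *-cancelˡ-≤ 2 (bound n (sparse n N≤n))
    where
    bound : ∀ n → 2 * K * misses P n ≤ n × 2 * K * misses Q n ≤ n →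
            2 * (K * misses (λ i → P i ∧ Q i) n) ≤ 2 * n
    bound n (P-sparse , Q-sparse) = begin
      2 * (K * misses (λ i → P i ∧ Q i) n)   ≡⟨ *-assoc 2 K _ ⟨
      2 * K * misses (λ i → P i ∧ Q i) n     ≤⟨ *-monoʳ-≤ (2 * K) (misses-∧ P Q n) ⟩
      2 * K * (misses P n + misses Q n)      ≡⟨ *-distribˡ-+ (2 * K) (misses P n) (misses Q n) ⟩
      2 * K * misses P n + 2 * K * misses Q n ≤⟨ +-mono-≤ P-sparse Q-sparse ⟩
      n + n                                  ≡⟨ cong (_+_ n) (+-identityʳ n) ⟨
      2 * n                                  ∎
      where open ≤-Reasoning

  hasDensityOne-all : ∀ {S : Set} (g : ℕ → S) Ws → All (λ W → HasDensityOne (W ∘ g)) Ws →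
                      HasDensityOne (λ n → all (λ W → W (g n)) Ws)
  hasDensityOne-all g []       []       = hasDensityOne-true
  hasDensityOne-all g (W ∷ Ws) (d ∷ ds) = hasDensityOne-∧ d (hasDensityOne-all g Ws ds)

  stalls-before : ∀ (h : ℕ → ℕ) B → h B < B + h 0 → ∃ λ b → b < B × h (suc b) ≤ h b
  stalls-before h zero    small = ⊥-elim (<-irrefl refl small)
  stalls-before h (suc B) small with h (suc B) ≤? h B
  ... | yes stall = B , n<1+n B , stall
  ... | no  grows with stalls-before h B (<-≤-trans (≰⇒> grows) (s≤s⁻¹ small))
  ...   | b , b<B , stall = b , m<n⇒m<1+n b<B , stall

  no-new-misses⇒run : ∀ P a L → misses P (a + L) ≤ misses P a → ∀ j → j < L → P (a + j) ≡ true
  no-new-misses⇒run P a L no-new j j<L with P (a + j) in Paj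
  ... | true  = refl
  ... | false = ⊥-elim (<-irrefl refl (begin-strict
    misses P a             ≤⟨ misses-mono P (m≤m+n a j) ⟩
    misses P (a + j)       <⟨ n<1+n _ ⟩
    suc (misses P (a + j)) ≡⟨ misses-false P (a + j) Paj ⟨
    misses P (suc (a + j)) ≤⟨ misses-mono P (subst (_≤ a + L) (+-suc a j) (+-monoʳ-≤ a j<L)) ⟩
    misses P (a + L)       ≤⟨ no-new ⟩
    misses P a             ∎))
    where open ≤-Reasoning

  hasDensityOne⇒longRuns : ∀ {P} → HasDensityOne P → HasLongRuns (λ n → P n ≡ true)
  hasDensityOne⇒longRuns     dense zero      = 0 , λ _ ()
  hasDensityOne⇒longRuns {P} dense L@(suc _) with dense (suc L)
  ... | N , sparse with stalls-before (λ b → misses P (b * L)) (suc N)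
                         (subst (misses P n <_) (sym (+-identityʳ (suc N))) few-misses)
    where
    n = suc N * L
    few-misses : misses P n < suc N
    few-misses = *-cancelˡ-< (suc L) _ _ (begin-strict
      suc L * misses P n   ≤⟨ sparse n (≤-trans (n≤1+n N) (m≤m*n (suc N) L)) ⟩
      suc N * L            ≡⟨ *-comm (suc N) L ⟩
      L * suc N            <⟨ m<n+m (L * suc N) (s≤s z≤n) ⟩
      suc N + L * suc N    ≡⟨⟩
      suc L * suc N        ∎)
      where open ≤-Reasoning
  ... | b , _ , stall =
    b * L , no-new-misses⇒run P (b * L) L (subst (λ k → misses P k ≤ misses P (b * L)) (+-comm L (b * L)) stall)

  bit-not+bit : ∀ b → bit (not b) + bit b ≡ 1
  bit-not+bit true  = refl
  bit-not+bit false = refl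

  misses+countℕ : ∀ W x → misses W (suc x) + countℕ W x ≡ suc x
  misses+countℕ W zero    = bit-not+bit (W 0)
  misses+countℕ W (suc x) = begin
    (misses W (suc x) + bit (not (W (suc x)))) + (countℕ W x + bit (W (suc x)))
      ≡⟨ interchange (misses W (suc x)) _ (countℕ W x) _ ⟩
    (misses W (suc x) + countℕ W x) + (bit (not (W (suc x))) + bit (W (suc x)))
      ≡⟨ cong₂ _+_ (misses+countℕ W x) (bit-not+bit (W (suc x))) ⟩
    suc x + 1
      ≡⟨ +-comm (suc x) 1 ⟩
    suc (suc x) ∎
    where open ≡-Reasoning

  countℤ≤countℕ+ : ∀ W x → countℤ W x ≤ countℕ (W ∘ +_) x + x
  countℤ≤countℕ+ W zero    = m≤m+n _ 0
  countℤ≤countℕ+ W (suc x) = begin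
    countℤ W x + bit (W (+ suc x)) + bit (W ℤ.-[1+ x ])
      ≤⟨ +-mono-≤ (+-monoˡ-≤ (bit (W (+ suc x))) (countℤ≤countℕ+ W x)) (bit≤1 (W ℤ.-[1+ x ])) ⟩
    countℕ (W ∘ +_) x + x + bit (W (+ suc x)) + 1
      ≡⟨ regroup (countℕ (W ∘ +_) x) x (bit (W (+ suc x))) ⟩
    countℕ (W ∘ +_) x + bit (W (+ suc x)) + suc x ∎
    where
    open ≤-Reasoning
    bit≤1 : ∀ b → bit b ≤ 1
    bit≤1 true  = ≤-refl
    bit≤1 false = z≤n
    regroup : ∀ a x b → a + x + b + 1 ≡ a + b + suc x
    regroup = solve-∀

  densityOneℕ⇒hasDensityOne : ∀ {W} → DensityOneℕ W → HasDensityOne W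
  densityOneℕ⇒hasDensityOne {W} dense K with dense 1/[1+ K ] (1/[1+]-pos K)
  ... | N , close = suc N , λ { (suc x) (s≤s N≤x) →
    <⇒≤ (gap-bound (misses W (suc x)) (countℕ W x) (suc x) K
                   (≤-reflexive (misses+countℕ W x)) (near-one (countℕ W x) x K (close x N≤x))) }

  -- On ℤ the window [−x, x] has 2x + 1 points, so density one is applied with 2K in place of K.
  densityOneℤ⇒hasDensityOne : ∀ {W} → DensityOneℤ W → HasDensityOne (W ∘ +_)
  densityOneℤ⇒hasDensityOne {W} dense K with dense 1/[1+ 2 * K ] (1/[1+]-pos (2 * K))
  ... | N , close = suc N , λ { (suc x) (s≤s N≤x) →
    few-misses x (near-one (countℤ W x) (x + x) (2 * K) (close x N≤x)) }
    where
    few-misses : ∀ x → (+ suc (x + x) ℤ.- + countℤ W x) ℤ.* + suc (2 * K) ℤ.< + suc (x + x) →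
                 K * misses (W ∘ +_) (suc x) ≤ suc x
    few-misses x gap = *-cancelˡ-≤ 2 (<⇒≤ (begin-strict
      2 * (K * m)       ≡⟨ *-assoc 2 K m ⟨
      2 * K * m         <⟨ gap-bound m (countℤ W x) (suc (x + x)) (2 * K) m+count≤ gap ⟩
      suc (x + x)       ≤⟨ s≤s (+-monoʳ-≤ x (n≤1+n x)) ⟩
      suc x + suc x     ≡⟨ cong (_+_ (suc x)) (+-identityʳ (suc x)) ⟨
      2 * suc x         ∎))
      where
      open ≤-Reasoning
      m = misses (W ∘ +_) (suc x)
      m+count≤ : m + countℤ W x ≤ suc (x + x)
      m+count≤ = begin
        m + countℤ W x                   ≤⟨ +-monoʳ-≤ m (countℤ≤countℕ+ W x) ⟩
        m + (countℕ (W ∘ +_) x + x)      ≡⟨ +-assoc m _ x ⟨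
        m + countℕ (W ∘ +_) x + x        ≡⟨ cong (_+ x) (misses+countℕ (W ∘ +_) x) ⟩
        suc (x + x)                      ∎

  densityOne-longRuns : ∀ {S : Set} {g : ℕ → S} {IsOpen : Subset S → Set} →
                        (∀ {W} → IsOpen W → HasDensityOne (W ∘ g)) → LongRunsInIntersections g IsOpen
  densityOne-longRuns {g = g} dense Ws oWs L
    with hasDensityOne⇒longRuns (hasDensityOne-all g Ws (All.map dense oWs)) L
  ... | a , run = a , λ j j<L →
    All.map (Equivalence.to T-≡) (AllP.all⁺ (λ W → W (g (a + j))) Ws (Equivalence.from T-≡ (run j j<L)))

longRuns⇒LIPSheaf : ∀ {S : Set} (ι : S → ℤ) (g : ℕ → S) {IsOpen} → (∀ {a b} → ι a ≡ ι b → a ≡ b) →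
                    (∀ n → ι (g n) ≡ + n) → LongRunsInIntersections g IsOpen → LIPSheaf S ι IsOpen
longRuns⇒LIPSheaf ι g {IsOpen} ι-injective ι∘g runs =
  locallyLIP⇒LIP ι ι-injective IsOpen (longRuns⇒meetsAllResidues ι∘g runs)

corollary4 : LIPSheaf ℕ +_ CofiniteOpen
           × LIPSheaf ℤ id CofiniteOpen
           × LIPSheaf ℕ +_ DensityOneℕ
           × LIPSheaf ℤ id DensityOneℤ
corollary4 =
    longRuns⇒LIPSheaf +_ id ℤP.+-injective (λ _ → refl) (cofinite-longRuns +_ id (λ _ → refl))
  , longRuns⇒LIPSheaf id +_ id (λ _ → refl) (cofinite-longRuns id +_ (λ _ → refl))
  , longRuns⇒LIPSheaf +_ id ℤP.+-injective (λ _ → refl) (densityOne-longRuns densityOneℕ⇒hasDensityOne)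
  , longRuns⇒LIPSheaf id +_ id (λ _ → refl) (densityOne-longRuns densityOneℤ⇒hasDensityOne)
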